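{- For all formulas $A,B,C,D$ of $\mathcal{L}_1$, the following sequents are valid in all Došen frames: (a) $A\backslash\!\!\backslash B\land A\backslash\!\!\backslash C\vdash A\backslash\!\!\backslash(B\land C)$ and $B/\!\!/A\land C/\!\!/A\vdash (B\land C)/\!\!/A$; (b) $A\backslash\!\!\backslash B\vdash A\backslash B\land A\backslash(A\backslash\!\!\backslash B)$ and $B/\!\!/A\vdash B/A\land (B/\!\!/A)/A$; (c) $A\backslash B\land A\backslash(A\backslash\!\!\backslash B)\vdash A\backslash\!\!\backslash B$ and $(B/\!\!/A)/A\land B/A\vdash B/\!\!/A$. Moreover, the following rules preserve validity in Došen models (if the premises are valid in a model $M$, so is the conclusion): (d) from $A\vdash B$ and $C\vdash D$ infer $B\backslash\!\!\backslash C\vdash A\backslash\!\!\backslash D$; and from $A\vdash B$ and $C\vdash D$ infer $C/\!\!/B\vdash D/\!\!/A$; (e) from $A\vdash B\backslash A$ infer $A\vdash B\backslash\!\!\backslash A$; and from $A\vdash A/B$ infer $A\vdash A/\!\!/B$.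
   Context: A Došen frame is $\langle S,R\rangle$ with $S$ non-empty and $R\subseteq S^3$; a Došen model adds $V$ mapping propositional variables to subsets of $S$. $\mathcal{L}_1$-formulas are built from variables, $\top,\bot$ and binary $\backslash,\bullet,/,\backslash\!\!\backslash,/\!\!/,\land,\lor$. Satisfaction: $s\vDash p$ iff $s\in V(p)$; $\top$ everywhere, $\bot$ nowhere; $\land,\lor$ classical; $s\vDash A\bullet B$ iff there are $t,u$ with $Rtus$, $t\vDash A$, $u\vDash B$; $s\vDash A\backslash B$ iff for all $t,u$, $Rtsu$ and $t\vDash A$ imply $u\vDash B$; $s\vDash B/A$ iff for all $t,u$, $Rstu$ and $t\vDash A$ imply $u\vDash B$; $s\vDash A\backslash\!\!\backslash B$ iff for all $t$ and all finite paths $\bar{x}$ (length $n\geq1$), $R\overleftarrow{x}st$ and $\bar{x}\vDash A$ imply $t\vDash B$; $s\vDash B/\!\!/A$ iff for all $t$ and all finite paths $\bar{x}$, $Rs\overrightarrow{x}t$ and $\bar{x}\vDash A$ imply $t\vDash B$. Here $\bar{x}=\langle x_1,\ldots,x_n\rangle$, $\bar{x}\vDash A$ means every $x_i\vDash A$; $R\overleftarrow{x}st$ means there exist $y_1,\ldots,y_{n-1}$ with $Rx_1sy_1$, $Rx_{i+1}y_iy_{i+1}$ ($1\le i\le n-2$), $Rx_ny_{n-1}t$ (for $n=1$: $Rx_1st$); $Rs\overrightarrow{x}t$ means there exist $y_1,\ldots,y_{n-1}$ with $Rsx_1y_1$, $Ry_ix_{i+1}y_{i+1}$ ($1\le i\le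 n-2$), $Ry_{n-1}x_nt$ (for $n=1$: $Rsx_1t$). A sequent $A\vdash B$ is valid in $M$ iff every state satisfying $A$ satisfies $B$; valid in a frame iff valid in every model based on it. -}

module Defs where

open import Data.Nat using (ℕ)
open import Data.Product using (Σ; ∃; _×_; _,_)
open import Data.Sum using (_⊎_)
open import Data.Unit using (⊤)
open import Data.Empty using (⊥)
open import Data.List using (List; []; _∷_)
open import Data.List.NonEmpty using (List⁺; _∷_)

infixr 20 _∧_
infixr 19 _∨_
data Formula : Set where
  var   : ℕ → Formula
  ⊤f ⊥f : Formula
  _＼_   : Formula → Formula → Formula
  _•_   : Formula → Formula → Formula
  _／_   : Formula → Formula → Formula
  _＼＼_  : Formula → Formula → Formula
  _／／_  : Formula → Formula → Formula
  _∧_   : Formula → Formula → Formula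
  _∨_   : Formula → Formula → Formula

record Frame : Set₁ where
  field
    S   : Set
    R   : S → S → S → Set
    inh : S

record Model : Set₁ where
  field
    frame : Frame
  open Frame frame public
  field
    V : ℕ → S → Set

module _ {S : Set} (R : S → S → S → Set) where
  -- R ⃖x s t, for x = x₁ … xₙ (n ≥ 1):
  --   ∃ y₁…y_{n-1}. R x₁ s y₁, R x_{i+1} y_i y_{i+1}, R xₙ y_{n-1} t
  LeftPathL : S → List S → S → S → Set
  LeftPathL x₁ []        s t = R x₁ s t
  LeftPathL x₁ (x₂ ∷ xs) s t = ∃ λ y → R x₁ s y × LeftPathL x₂ xs y t

  LeftPath : List⁺ S → S → S → Set
  LeftPath (x ∷ xs) = LeftPathL x xs

  -- R s ⃗x t:
  --   ∃ y₁…y_{n-1}. R s x₁ y₁, R y_i x_{i+1} y_{i+1}, R y_{n-1} xₙ t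
  RightPathL : S → S → List S → S → Set
  RightPathL s x₁ []        t = R s x₁ t
  RightPathL s x₁ (x₂ ∷ xs) t = ∃ λ y → R s x₁ y × RightPathL y x₂ xs t

  RightPath : S → List⁺ S → S → Set
  RightPath s (x ∷ xs) = RightPathL s x xs

module _ (M : Model) where
  open Model M

  infix 4 _⊨_
  _⊨_ : S → Formula → Set
  _⊨*_ : List⁺ S → Formula → Set
  _⊨L_ : List S → Formula → Set

  s ⊨ var p    = V p s
  s ⊨ ⊤f       = ⊤
  s ⊨ ⊥f       = ⊥
  s ⊨ (A • B)  = ∃ λ t → ∃ λ u → R t u s × t ⊨ A × u ⊨ B
  s ⊨ (A ＼ B)  = ∀ t u → R t s u → t ⊨ A → u ⊨ B
  s ⊨ (B ／ A)  = ∀ t u → R s t u → t ⊨ A → u ⊨ B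
  s ⊨ (A ＼＼ B) = ∀ t (x : List⁺ S) → LeftPath R x s t → x ⊨* A → t ⊨ B
  s ⊨ (B ／／ A) = ∀ t (x : List⁺ S) → RightPath R s x t → x ⊨* A → t ⊨ B
  s ⊨ (A ∧ B)  = s ⊨ A × s ⊨ B
  s ⊨ (A ∨ B)  = s ⊨ A ⊎ s ⊨ B

  (x ∷ xs) ⊨* A = x ⊨ A × xs ⊨L A

  []       ⊨L A = ⊤
  (y ∷ ys) ⊨L A = y ⊨ A × ys ⊨L A

  ValidIn : Formula → Formula → Set
  ValidIn A B = ∀ (s : S) → s ⊨ A → s ⊨ B

ValidInFrame : Frame → Formula → Formula → Set₁
ValidInFrame F A B = ∀ (V : ℕ → Frame.S F → Set) →
  ValidIn (record { frame = F ; V = V }) A B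

module Submission where

-- Everything is a direct unfolding of the Došen semantics; the
-- only real structure is that paths are built step by step:
--   R ⃖⟨x₁,…,xₙ⟩ s t  is  R x₁ s t  for n = 1, and  ∃y. R x₁ s y × R ⃖⟨x₂,…,xₙ⟩ y t
-- otherwise (dually for R s ⃗x t).  Hence  A \\ B  is the "iterated" residual:
-- it is equivalent to  A \ B ∧ A \ (A \\ B)  (parts (b) and (c)), obtained by
-- splitting off the first step of a path.  Part (a) holds because \\ and //
-- quantify universally over their conclusion, part (d) because they are
-- antitone in the path formula (pointwise on lists of states) and monotone in
-- the conclusion, and part (e) is an induction along paths: a set of states
-- closed under single B-steps is closed under B-paths.

open import Defs
open import Data.Product using (_×_; _,_)
open import Data.Unit using (tt)
open import Data.List using (List; []; _∷_)
open import Data.List.NonEmpty using (_∷_)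

module Semantics (M : Model) where
  open Model M

  infix 4 _⊩_ _⊩L_
  _⊩_ : S → Formula → Set
  _⊩_ = _⊨_ M

  _⊩L_ : List S → Formula → Set
  _⊩L_ = _⊨L_ M

  ⊩L-mono : ∀ {A B} → ValidIn M A B → ∀ xs → xs ⊩L A → xs ⊩L B
  ⊩L-mono A⊢B []       tt          = tt
  ⊩L-mono A⊢B (x ∷ xs) (x⊩A , xs⊩A) = A⊢B x x⊩A , ⊩L-mono A⊢B xs xs⊩A

  left-path-induction :
    ∀ (P : S → Set) {B} → (∀ s x t → P s → R x s t → x ⊩ B → P t) →
    ∀ x xs s t → P s → LeftPathL R x xs s t → x ⊩ B → xs ⊩L B → P t
  left-path-induction P step x []         s t Ps Rxst         x⊩B _ =
    step s x t Ps Rxst x⊩B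
  left-path-induction P step x (x′ ∷ xs) s t Ps (y , Rxsy , path) x⊩B (x′⊩B , xs⊩B) =
    left-path-induction P step x′ xs y t (step s x y Ps Rxsy x⊩B) path x′⊩B xs⊩B

  right-path-induction :
    ∀ (P : S → Set) {B} → (∀ s x t → P s → R s x t → x ⊩ B → P t) →
    ∀ s x xs t → P s → RightPathL R s x xs t → x ⊩ B → xs ⊩L B → P t
  right-path-induction P step s x []         t Ps Rsxt         x⊩B _ =
    step s x t Ps Rsxt x⊩B
  right-path-induction P step s x (x′ ∷ xs) t Ps (y , Rsxy , path) x⊩B (x′⊩B , xs⊩B) =
    right-path-induction P step y x′ xs t (step s x y Ps Rsxy x⊩B) path x′⊩B xs⊩B

  ＼＼-∧ : ∀ A B C → ValidIn M ((A ＼＼ B) ∧ (A ＼＼ C)) (A ＼＼ (B ∧ C))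
  ＼＼-∧ A B C s (s⊩A＼＼B , s⊩A＼＼C) t x path x⊩A =
    s⊩A＼＼B t x path x⊩A , s⊩A＼＼C t x path x⊩A

  ／／-∧ : ∀ A B C → ValidIn M ((B ／／ A) ∧ (C ／／ A)) ((B ∧ C) ／／ A)
  ／／-∧ A B C s (s⊩B／／A , s⊩C／／A) t x path x⊩A =
    s⊩B／／A t x path x⊩A , s⊩C／／A t x path x⊩A

  ＼＼-unfold : ∀ A B → ValidIn M (A ＼＼ B) ((A ＼ B) ∧ (A ＼ (A ＼＼ B)))
  ＼＼-unfold A B s s⊩A＼＼B =
      (λ x t Rxst x⊩A → s⊩A＼＼B t (x ∷ []) Rxst (x⊩A , tt))
    , λ { x y Rxsy x⊩A t (x′ ∷ xs) path x′xs⊩A →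
            s⊩A＼＼B t (x ∷ x′ ∷ xs) (y , Rxsy , path) (x⊩A , x′xs⊩A) }

  ／／-unfold : ∀ A B → ValidIn M (B ／／ A) ((B ／ A) ∧ ((B ／／ A) ／ A))
  ／／-unfold A B s s⊩B／／A =
      (λ x t Rsxt x⊩A → s⊩B／／A t (x ∷ []) Rsxt (x⊩A , tt))
    , λ { x y Rsxy x⊩A t (x′ ∷ xs) path x′xs⊩A →
            s⊩B／／A t (x ∷ x′ ∷ xs) (y , Rsxy , path) (x⊩A , x′xs⊩A) }

  ＼＼-fold : ∀ A B → ValidIn M ((A ＼ B) ∧ (A ＼ (A ＼＼ B))) (A ＼＼ B)
  ＼＼-fold A B s (s⊩A＼B , _) t (x ∷ []) Rxst (x⊩A , tt) = s⊩A＼B x t Rxst x⊩A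
  ＼＼-fold A B s (_ , s⊩A＼A＼＼B) t (x ∷ x′ ∷ xs) (y , Rxsy , path) (x⊩A , x′xs⊩A) =
    s⊩A＼A＼＼B x y Rxsy x⊩A t (x′ ∷ xs) path x′xs⊩A

  ／／-fold : ∀ A B → ValidIn M (((B ／／ A) ／ A) ∧ (B ／ A)) (B ／／ A)
  ／／-fold A B s (_ , s⊩B／A) t (x ∷ []) Rsxt (x⊩A , tt) = s⊩B／A x t Rsxt x⊩A
  ／／-fold A B s (s⊩B／／A／A , _) t (x ∷ x′ ∷ xs) (y , Rsxy , path) (x⊩A , x′xs⊩A) =
    s⊩B／／A／A x y Rsxy x⊩A t (x′ ∷ xs) path x′xs⊩A

  ＼＼-mono : ∀ A B C D → ValidIn M A B → ValidIn M C D → ValidIn M (B ＼＼ C) (A ＼＼ D)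
  ＼＼-mono A B C D A⊢B C⊢D s s⊩B＼＼C t (x ∷ xs) path (x⊩A , xs⊩A) =
    C⊢D t (s⊩B＼＼C t (x ∷ xs) path (A⊢B x x⊩A , ⊩L-mono A⊢B xs xs⊩A))

  ／／-mono : ∀ A B C D → ValidIn M A B → ValidIn M C D → ValidIn M (C ／／ B) (D ／／ A)
  ／／-mono A B C D A⊢B C⊢D s s⊩C／／B t (x ∷ xs) path (x⊩A , xs⊩A) =
    C⊢D t (s⊩C／／B t (x ∷ xs) path (A⊢B x x⊩A , ⊩L-mono A⊢B xs xs⊩A))

  -- (e) Induction rule: A ⊢ B \ A says the A-states are closed under single
  -- B-steps, hence under B-paths.
  ＼＼-induction : ∀ A B → ValidIn M A (B ＼ A) → ValidIn M A (B ＼＼ A)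
  ＼＼-induction A B A⊢B＼A s s⊩A t (x ∷ xs) path (x⊩B , xs⊩B) =
    left-path-induction (_⊩ A) (λ s x t s⊩A Rxst x⊩B → A⊢B＼A s s⊩A x t Rxst x⊩B)
      x xs s t s⊩A path x⊩B xs⊩B

  ／／-induction : ∀ A B → ValidIn M A (A ／ B) → ValidIn M A (A ／／ B)
  ／／-induction A B A⊢A／B s s⊩A t (x ∷ xs) path (x⊩B , xs⊩B) =
    right-path-induction (_⊩ A) (λ s x t s⊩A Rsxt x⊩B → A⊢A／B s s⊩A x t Rsxt x⊩B)
      s x xs t s⊩A path x⊩B xs⊩B

open Semantics

proposition2 :
    (∀ (F : Frame) (A B C : Formula) →
        ValidInFrame F ((A ＼＼ B) ∧ (A ＼＼ C)) (A ＼＼ (B ∧ C))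
      × ValidInFrame F ((B ／／ A) ∧ (C ／／ A)) ((B ∧ C) ／／ A))
    × (∀ (F : Frame) (A B : Formula) →
        ValidInFrame F (A ＼＼ B) ((A ＼ B) ∧ (A ＼ (A ＼＼ B)))
      × ValidInFrame F (B ／／ A) ((B ／ A) ∧ ((B ／／ A) ／ A)))
    × (∀ (F : Frame) (A B : Formula) →
        ValidInFrame F ((A ＼ B) ∧ (A ＼ (A ＼＼ B))) (A ＼＼ B)
      × ValidInFrame F (((B ／／ A) ／ A) ∧ (B ／ A)) (B ／／ A))
    × (∀ (M : Model) (A B C D : Formula) →
        ValidIn M A B → ValidIn M C D →
          ValidIn M (B ＼＼ C) (A ＼＼ D)
        × ValidIn M (C ／／ B) (D ／／ A))
    × (∀ (M : Model) (A B : Formula) →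
        (ValidIn M A (B ＼ A) → ValidIn M A (B ＼＼ A))
      × (ValidIn M A (A ／ B) → ValidIn M A (A ／／ B)))
proposition2 =
    (λ F A B C → (λ V → ＼＼-∧ _ A B C) , (λ V → ／／-∧ _ A B C))
  , (λ F A B → (λ V → ＼＼-unfold _ A B) , (λ V → ／／-unfold _ A B))
  , (λ F A B → (λ V → ＼＼-fold _ A B) , (λ V → ／／-fold _ A B))
  , (λ M A B C D A⊢B C⊢D → ＼＼-mono M A B C D A⊢B C⊢D , ／／-mono M A B C D A⊢B C⊢D)
  , (λ M A B → ＼＼-induction M A B , ／／-induction M A B)
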